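{- Let $(\mathcal{P},\mathcal{B})$ be the design defined below and let $$C_1=\{B_1^{11},B_2^1,B_3^1,B_4^{10},B_5^{10},B_6^{11},B_7^6,B_9^{12},B_{10}^4,B_{11}^0,B_{11}^2,B_{11}^3,B_{11}^7\}.$$ For every $e\in\mathbb{Z}_{13}$, the set $C_1^e=\{B^e: B\in C_1\}$ is a non-canonical maximum clique in the block graph of $(\mathcal{P},\mathcal{B})$, where for a block $B=B_i^{f}$ we write $B^e=B_i^{f+e}$.
   Context: Point set: $\mathcal{P}=\mathbb{Z}_{13}\times(\{0,1,2\}\cup\{a,b\})\cup\{\infty\}$ ($66$ points); the point $(i,x)$ is written $i_x$. Basic blocks: $B_1=\{2_0,5_0,4_1,9_1,0_a,6_a\}$, $B_2=\{1_0,2_0,6_0,12_2,5_b,8_b\}$, $B_3=\{6_1,2_1,12_2,1_2,0_a,5_a\}$, $B_4=\{3_1,6_1,5_1,10_0,2_b,11_b\}$, $B_5=\{5_2,6_2,10_0,3_0,0_a,2_a\}$, $B_6=\{9_2,5_2,2_2,4_1,6_b,7_b\}$, $B_7=\{7_0,9_0,10_1,1_2,3_a,4_b\}$, $B_8=\{2_a,6_a,5_a,4_b,12_b,10_b\}$, $B_9=\{8_1,1_1,4_2,3_0,9_a,12_b\}$, $B_{10}=\{11_2,3_2,12_0,9_1,1_a,10_b\}$, $B_{11}=\{\infty,0_0,0_1,0_2,0_a,0_b\}$. For $e\in\mathbb{Z}_{13}$, $B_i^e$ is obtained from $B_i$ by replacing each point $j_x$ by $(j+e)_x$ (addition mod $13$)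 and fixing $\infty$. The block set is $\mathcal{B}=\{B_i^e: 1\le i\le 11,\ e\in\mathbb{Z}_{13}\}$ ($143$ blocks); $(\mathcal{P},\mathcal{B})$ is a $2$-$(66,6,1)$ design. The block graph has the blocks as vertices, two distinct blocks adjacent iff they intersect. A maximum clique here has size $13$; a maximum clique is canonical if it consists of all blocks containing a fixed point, and non-canonical otherwise. -}

module Defs where

open import Data.Nat using (ℕ; _+_; _≤_)
open import Data.Nat.DivMod using (_mod_)
open import Data.Fin using (Fin; toℕ; #_)
open import Data.Product using (_×_; _,_; ∃; proj₁; proj₂)
open import Data.List using (List; []; _∷_; map; length)
open import Data.List.Membership.Propositional using (_∈_)
open import Data.List.Relation.Unary.Unique.Propositional using (Unique)
open import Relation.Binary.PropositionalEquality using (_≡_; _≢_)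
open import Relation.Nullary using (¬_)
open import Function.Bundles using (_⇔_)

data Sym : Set where
  s0 s1 s2 sa sb : Sym

data Point : Set where
  pt  : Fin 13 → Sym → Point
  ∞   : Point

_⊕_ : Fin 13 → Fin 13 → Fin 13
a ⊕ b = (toℕ a + toℕ b) mod 13

shift : Fin 13 → Point → Point
shift e (pt j x) = pt (j ⊕ e) x
shift e ∞        = ∞

_₀ _₁ _₂ _ₐ _ᵦ : ℕ → Point
n ₀ = pt (n mod 13) s0
n ₁ = pt (n mod 13) s1
n ₂ = pt (n mod 13) s2
n ₐ = pt (n mod 13) sa
n ᵦ = pt (n mod 13) sb

-- basic blocks B_1, ..., B_11 (index k : Fin 11 stands for B_{k+1})
base : Fin 11 → List Point
base Fin.zero = 2 ₀ ∷ 5 ₀ ∷ 4 ₁ ∷ 9 ₁ ∷ 0 ₐ ∷ 6 ₐ ∷ []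
base (Fin.suc Fin.zero) = 1 ₀ ∷ 2 ₀ ∷ 6 ₀ ∷ 12 ₂ ∷ 5 ᵦ ∷ 8 ᵦ ∷ []
base (Fin.suc (Fin.suc Fin.zero)) = 6 ₁ ∷ 2 ₁ ∷ 12 ₂ ∷ 1 ₂ ∷ 0 ₐ ∷ 5 ₐ ∷ []
base (Fin.suc (Fin.suc (Fin.suc Fin.zero))) = 3 ₁ ∷ 6 ₁ ∷ 5 ₁ ∷ 10 ₀ ∷ 2 ᵦ ∷ 11 ᵦ ∷ []
base (Fin.suc (Fin.suc (Fin.suc (Fin.suc Fin.zero)))) = 5 ₂ ∷ 6 ₂ ∷ 10 ₀ ∷ 3 ₀ ∷ 0 ₐ ∷ 2 ₐ ∷ []
base (Fin.suc (Fin.suc (Fin.suc (Fin.suc (Fin.suc Fin.zero))))) = 9 ₂ ∷ 5 ₂ ∷ 2 ₂ ∷ 4 ₁ ∷ 6 ᵦ ∷ 7 ᵦ ∷ []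
base (Fin.suc (Fin.suc (Fin.suc (Fin.suc (Fin.suc (Fin.suc Fin.zero)))))) = 7 ₀ ∷ 9 ₀ ∷ 10 ₁ ∷ 1 ₂ ∷ 3 ₐ ∷ 4 ᵦ ∷ []
base (Fin.suc (Fin.suc (Fin.suc (Fin.suc (Fin.suc (Fin.suc (Fin.suc Fin.zero))))))) = 2 ₐ ∷ 6 ₐ ∷ 5 ₐ ∷ 4 ᵦ ∷ 12 ᵦ ∷ 10 ᵦ ∷ []
base (Fin.suc (Fin.suc (Fin.suc (Fin.suc (Fin.suc (Fin.suc (Fin.suc (Fin.suc Fin.zero)))))))) = 8 ₁ ∷ 1 ₁ ∷ 4 ₂ ∷ 3 ₀ ∷ 9 ₐ ∷ 12 ᵦ ∷ []
base (Fin.suc (Fin.suc (Fin.suc (Fin.suc (Fin.suc (Fin.suc (Fin.suc (Fin.suc (Fin.suc Fin.zero))))))))) = 11 ₂ ∷ 3 ₂ ∷ 12 ₀ ∷ 9 ₁ ∷ 1 ₐ ∷ 10 ᵦ ∷ []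
base (Fin.suc (Fin.suc (Fin.suc (Fin.suc (Fin.suc (Fin.suc (Fin.suc (Fin.suc (Fin.suc (Fin.suc Fin.zero)))))))))) = ∞ ∷ 0 ₀ ∷ 0 ₁ ∷ 0 ₂ ∷ 0 ₐ ∷ 0 ᵦ ∷ []

-- A block of the design is named by a label (i , e), meaning B_{i+1}^e.
-- The 143 labels give 143 pairwise distinct blocks, so labels serve as
-- the vertices of the block graph.
Label : Set
Label = Fin 11 × Fin 13

block : Label → List Point
block (i , e) = map (shift e) (base i)

-- adjacency in the block graph (distinctness is imposed separately)
Intersect : Label → Label → Set
Intersect B B′ = ∃ λ p → p ∈ block B × p ∈ block B′

IsClique : List Label → Set
IsClique C = Unique C × (∀ {B B′} → B ∈ C → B′ ∈ C → B ≢ B′ → Intersect B B′)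

IsMaximumClique : List Label → Set
IsMaximumClique C = IsClique C × (∀ D → IsClique D → length D ≤ length C)

IsCanonical : List Label → Set
IsCanonical C = ∃ λ p → ∀ B → (B ∈ C) ⇔ (p ∈ block B)

shiftLabel : Fin 13 → Label → Label
shiftLabel e (i , f) = (i , f ⊕ e)

shiftClique : Fin 13 → List Label → List Label
shiftClique e C = map (shiftLabel e) C

-- labels: B_k^f is written lab k f (1 ≤ k ≤ 11)
lab : ℕ → ℕ → Label
lab k f = (k Data.Nat.∸ 1) mod 11 , f mod 13

C₁ : List Label
C₁ = lab 1 11 ∷ lab 2 1 ∷ lab 3 1 ∷ lab 4 10 ∷ lab 5 10 ∷ lab 6 11 ∷ lab 7 6
   ∷ lab 9 12 ∷ lab 10 4 ∷ lab 11 0 ∷ lab 11 2 ∷ lab 11 3 ∷ lab 11 7 ∷ []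

-- Every clique is duplicate-free, hence a reordering of a sublist of the list of all 143
-- blocks, so the clique number is bounded by a branch-and-bound search over that list: a list
-- admits no clique larger than k if it has at most k entries, or if the neighbours of its head
-- admit none larger than k - 1 and its tail none larger than k.  The search succeeds for
-- k = 13.  Each translate of C₁ consists of 13 pairwise intersecting blocks with no point
-- common to all of them, whereas all blocks of a canonical clique share its defining point.
module Submission where

open import Defs

open import Data.Bool using (Bool; true; false; T; _∨_; _∧_)
open import Data.Bool.Properties using (T-∨; T-∧; T-≡)
open import Data.Empty using (⊥-elim)
open import Data.Fin using (Fin; toℕ)
import Data.Fin.Properties as Fin
open import Data.List using (List; []; _∷_; map; length; filter; filterᵇ; cartesianProduct; allFin)
open import Data.List.Properties using (filter-all; length-map)
open import Data.List.Membership.Propositional using (_∈_; find; lose)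
open import Data.List.Membership.Propositional.Properties using (∈-map⁺; ∈-filter⁺; ∈-filter⁻; ∈-cartesianProduct⁺; ∈-allFin)
open import Data.List.Membership.Propositional.Properties.WithK using (unique∧set⇒bag)
import Data.List.Membership.DecPropositional as DecMembership
open import Data.List.Relation.Binary.BagAndSetEquality using (∼bag⇒↭)
open import Data.List.Relation.Binary.Permutation.Propositional.Properties using (↭-length)
open import Data.List.Relation.Binary.Sublist.Propositional using (_⊆_; []; _∷_; _∷ʳ_)
import Data.List.Relation.Binary.Sublist.Propositional.Properties as Sublist
open import Data.List.Relation.Unary.All as All using (All; []; _∷_)
open import Data.List.Relation.Unary.AllPairs as AllPairs using (AllPairs; []; _∷_; allPairs?)
import Data.List.Relation.Unary.AllPairs.Properties as AllPairs
open import Data.List.Relation.Unary.Any using (Any; here; there; any?)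
open import Data.List.Relation.Unary.Unique.Propositional using (Unique)
import Data.List.Relation.Unary.Unique.Propositional.Properties as Unique
open import Data.List.Relation.Unary.Unique.DecPropositional using (unique?)
open import Data.Nat using (ℕ; zero; suc; _≤_; _≤ᵇ_; _≡ᵇ_; _+_; _*_; z≤n; s≤s)
open import Data.Nat.Properties using (≤ᵇ⇒≤; ≡⇒≡ᵇ; ≤-trans; module ≤-Reasoning)
import Data.Nat.Properties as ℕ
open import Data.Product using (_×_; _,_; proj₂; ∃)
open import Data.Product.Properties using (≡-dec)
open import Data.Sum using (inj₁; inj₂)
open import Function using (_∘_; id; _⇔_; mk⇔; Equivalence)
open import Relation.Binary using (Rel; Symmetric; DecidableEquality)
open import Relation.Binary.PropositionalEquality using (_≡_; _≢_; refl; sym; trans; cong; subst)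
open import Relation.Nullary using (¬_; Dec; does; yes; no; ¬?; _×-dec_; map′)
open import Relation.Nullary.Decidable using (T?)

module CliqueBound {A : Set} (adj : A → A → Bool) where

  Clique : List A → Set
  Clique = AllPairs (λ u v → T (adj u v))

  cliqueBound : List A → ℕ → Bool
  cliqueBound []      k       = true
  cliqueBound (v ∷ S) zero    = false
  cliqueBound (v ∷ S) (suc k) =
    (length S ≤ᵇ k) ∨ (cliqueBound (filterᵇ (adj v) S) k ∧ cliqueBound S (suc k))

  ⊆-filterᵇ : ∀ (p : A → Bool) {D S} → All (T ∘ p) D → D ⊆ S → D ⊆ filterᵇ p S
  ⊆-filterᵇ p {D} {S} all D⊆S =
    subst (_⊆ filterᵇ p S) (filter-all (T? ∘ p) all)
          (Sublist.filter⁺ (T? ∘ p) (T? ∘ p) (λ { refl → id }) D⊆S)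

  cliqueBound-sound : ∀ S k {D} → cliqueBound S k ≡ true → D ⊆ S → Clique D → length D ≤ k
  cliqueBound-sound S k bound = bounded S k (Equivalence.from T-≡ bound)
    where
    bounded : ∀ S k {D} → T (cliqueBound S k) → D ⊆ S → Clique D → length D ≤ k
    bounded []      k       _  [] _ = z≤n
    bounded (v ∷ S) zero    () _  _
    bounded (v ∷ S) (suc k) bound D⊆vS clique with Equivalence.to T-∨ bound
    ... | inj₁ short = ≤-trans (Sublist.length-mono-≤ D⊆vS) (s≤s (≤ᵇ⇒≤ _ _ short))
    ... | inj₂ split with Equivalence.to T-∧ split | D⊆vS | clique
    ...   | _ , boundS | v ∷ʳ D⊆S   | clique′ = bounded S (suc k) boundS D⊆S clique′
    ...   | boundN , _ | refl ∷ D⊆S | adjv ∷ clique′ =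
      s≤s (bounded (filterᵇ (adj v) S) k boundN (⊆-filterᵇ (adj v) adjv D⊆S) clique′)

module _ {A : Set} {ℓ} {R : Rel A ℓ} where

  allPairs⇒pairwise : Symmetric R → ∀ {xs} → AllPairs R xs →
                      ∀ {x y} → x ∈ xs → y ∈ xs → x ≢ y → R x y
  allPairs⇒pairwise R-sym (_ ∷ _)      (here refl) (here refl) x≢y = ⊥-elim (x≢y refl)
  allPairs⇒pairwise R-sym (Rx ∷ _)     (here refl) (there y∈)  _   = All.lookup Rx y∈
  allPairs⇒pairwise R-sym (Ry ∷ _)     (there x∈)  (here refl) _   = R-sym (All.lookup Ry x∈)
  allPairs⇒pairwise R-sym (_ ∷ pairs) (there x∈)  (there y∈)  x≢y =
    allPairs⇒pairwise R-sym pairs x∈ y∈ x≢y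

  pairwise⇒allPairs : ∀ {xs} → Unique xs → (∀ {x y} → x ∈ xs → y ∈ xs → x ≢ y → R x y) →
                      AllPairs R xs
  pairwise⇒allPairs []            _ = []
  pairwise⇒allPairs (x∉ ∷ unique) R-pairwise =
    All.tabulate (λ y∈ → R-pairwise (here refl) (there y∈) (All.lookup x∉ y∈))
    ∷ pairwise⇒allPairs unique (λ x∈ y∈ → R-pairwise (there x∈) (there y∈))

module _ {A : Set} (_≟_ : DecidableEquality A)
         {U : List A} (U-unique : Unique U) (∈U : ∀ x → x ∈ U) where
  open DecMembership _≟_ using (_∈?_)

  length-filter-∈? : ∀ {D} → Unique D → length (filter (_∈? D) U) ≡ length D
  length-filter-∈? {D} D-unique =
    ↭-length (∼bag⇒↭ (unique∧set⇒bag (Unique.filter⁺ (_∈? D) U-unique) D-unique same-elements))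
    where
    same-elements : ∀ {x} → x ∈ filter (_∈? D) U ⇔ x ∈ D
    same-elements = mk⇔ (proj₂ ∘ ∈-filter⁻ (_∈? D) {xs = U}) (∈-filter⁺ (_∈? D) (∈U _))

symCode : Sym → ℕ
symCode s0 = 0
symCode s1 = 1
symCode s2 = 2
symCode sa = 3
symCode sb = 4

symDecode : ℕ → Sym
symDecode 0 = s0
symDecode 1 = s1
symDecode 2 = s2
symDecode 3 = sa
symDecode _ = sb

symDecode-symCode : ∀ x → symDecode (symCode x) ≡ x
symDecode-symCode s0 = refl
symDecode-symCode s1 = refl
symDecode-symCode s2 = refl
symDecode-symCode sa = refl
symDecode-symCode sb = refl

symCode-injective : ∀ {x y} → symCode x ≡ symCode y → x ≡ y
symCode-injective {x} {y} eq =
  trans (sym (symDecode-symCode x)) (trans (cong symDecode eq) (symDecode-symCode y))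

_≟ˢ_ : DecidableEquality Sym
x ≟ˢ y = map′ symCode-injective (cong symCode) (symCode x ℕ.≟ symCode y)

pt-injective : ∀ {i j x y} → pt i x ≡ pt j y → i ≡ j × x ≡ y
pt-injective refl = refl , refl

_≟ᵖ_ : DecidableEquality Point
pt i x ≟ᵖ pt j y = map′ (λ { (refl , refl) → refl }) pt-injective ((i Fin.≟ j) ×-dec (x ≟ˢ y))
pt i x ≟ᵖ ∞      = no λ ()
∞      ≟ᵖ pt j y = no λ ()
∞      ≟ᵖ ∞      = yes refl

_≟ˡ_ : DecidableEquality Label
_≟ˡ_ = ≡-dec Fin._≟_ Fin._≟_

open DecMembership _≟ᵖ_ using (_∈?_)

intersect? : ∀ B B′ → Dec (Intersect B B′)
intersect? B B′ =
  map′ witness (λ (p , p∈B , p∈B′) → lose p∈B p∈B′) (any? (_∈? block B′) (block B))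
  where
  witness : Any (_∈ block B′) (block B) → Intersect B B′
  witness common with find common
  ... | p , p∈B , p∈B′ = p , p∈B , p∈B′

intersect-sym : Symmetric Intersect
intersect-sym (p , p∈B , p∈B′) = p , p∈B′ , p∈B

allLabels : List Label
allLabels = cartesianProduct (allFin 11) (allFin 13)

allLabels-unique : Unique allLabels
allLabels-unique = Unique.cartesianProduct⁺ (Unique.allFin⁺ 11) (Unique.allFin⁺ 13)

∈-allLabels : ∀ B → B ∈ allLabels
∈-allLabels (i , e) = ∈-cartesianProduct⁺ (∈-allFin i) (∈-allFin e)

pointCode : Point → ℕ
pointCode (pt i x) = 5 * toℕ i + symCode x
pointCode ∞        = 65

blockCodes : Label → List ℕ
blockCodes B = map pointCode (block B)

elemᵇ : ℕ → List ℕ → Bool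
elemᵇ x []       = false
elemᵇ x (y ∷ ys) = (x ≡ᵇ y) ∨ elemᵇ x ys

meetsᵇ : List ℕ → List ℕ → Bool
meetsᵇ []       ys = false
meetsᵇ (x ∷ xs) ys = elemᵇ x ys ∨ meetsᵇ xs ys

elemᵇ-complete : ∀ {x ys} → x ∈ ys → T (elemᵇ x ys)
elemᵇ-complete {x} (here refl) = Equivalence.from T-∨ (inj₁ (≡⇒≡ᵇ x x refl))
elemᵇ-complete     (there x∈)  = Equivalence.from T-∨ (inj₂ (elemᵇ-complete x∈))

meetsᵇ-complete : ∀ {x xs ys} → x ∈ xs → x ∈ ys → T (meetsᵇ xs ys)
meetsᵇ-complete (here refl) x∈ys = Equivalence.from T-∨ (inj₁ (elemᵇ-complete x∈ys))
meetsᵇ-complete (there x∈) x∈ys  = Equivalence.from T-∨ (inj₂ (meetsᵇ-complete x∈ x∈ys))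

intersect⇒meetsᵇ : ∀ {B B′} → Intersect B B′ → T (meetsᵇ (blockCodes B) (blockCodes B′))
intersect⇒meetsᵇ (p , p∈B , p∈B′) =
  meetsᵇ-complete (∈-map⁺ pointCode p∈B) (∈-map⁺ pointCode p∈B′)

open CliqueBound using (cliqueBound; cliqueBound-sound)

-- Stated with ≡ true and proved by refl: checking a T-typed certificate instead makes Agda
-- run the search with a much slower evaluator.
blockGraph-cliqueBound : cliqueBound meetsᵇ (map blockCodes allLabels) 13 ≡ true
blockGraph-cliqueBound = refl

open DecMembership _≟ˡ_ using () renaming (_∈?_ to _∈ˡ?_)

clique-length≤13 : ∀ D → IsClique D → length D ≤ 13
clique-length≤13 D (D-unique , D-pairwise) = begin
  length D                    ≡⟨ length-filter-∈? _≟ˡ_ allLabels-unique ∈-allLabels D-unique ⟨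
  length D′                   ≡⟨ length-map blockCodes D′ ⟨
  length (map blockCodes D′)  ≤⟨ cliqueBound-sound meetsᵇ (map blockCodes allLabels) 13
                                   blockGraph-cliqueBound
                                   (Sublist.map⁺ blockCodes (Sublist.filter-⊆ (_∈ˡ? D) allLabels))
                                   (AllPairs.map⁺ (AllPairs.map intersect⇒meetsᵇ D′-clique)) ⟩
  13                          ∎
  where
  open ≤-Reasoning
  D′ : List Label
  D′ = filter (_∈ˡ? D) allLabels
  D′-clique : AllPairs Intersect D′
  D′-clique = pairwise⇒allPairs (Unique.filter⁺ (_∈ˡ? D) allLabels-unique)
    (λ x∈ y∈ → D-pairwise (∈D x∈) (∈D y∈))
    where
    ∈D : ∀ {B} → B ∈ D′ → B ∈ D
    ∈D = proj₂ ∘ ∈-filter⁻ (_∈ˡ? D) {xs = allLabels}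

CommonPoint : List Label → Set
CommonPoint C = ∃ λ p → All (λ B → p ∈ block B) C

canonical⇒commonPoint : ∀ {C} → IsCanonical C → CommonPoint C
canonical⇒commonPoint (p , through-p) = p , All.tabulate (λ {B} → Equivalence.to (through-p B))

commonPoint? : ∀ C → Dec (CommonPoint C)
commonPoint? []      = yes (∞ , [])
commonPoint? (B ∷ C) = map′ witness (λ (p , on-all) → lose (All.head on-all) on-all)
                              (any? (λ p → All.all? (λ B′ → p ∈? block B′) (B ∷ C)) (block B))
  where
  witness : Any (λ p → All (λ B′ → p ∈ block B′) (B ∷ C)) (block B) → CommonPoint (B ∷ C)
  witness common with find common
  ... | p , _ , on-all = p , on-all

CommonPointFreeClique : List Label → Set
CommonPointFreeClique C = Unique C × AllPairs Intersect C × ¬ CommonPoint C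

commonPointFreeClique? : ∀ C → Dec (CommonPointFreeClique C)
commonPointFreeClique? C = unique? _≟ˡ_ C ×-dec allPairs? intersect? C ×-dec ¬? (commonPoint? C)

does≡true⇒ : ∀ {P : Set} (P? : Dec P) → does P? ≡ true → P
does≡true⇒ (yes p) _ = p

C₁-translates-commonPointFree : ∀ e → CommonPointFreeClique (shiftClique e C₁)
C₁-translates-commonPointFree =
  does≡true⇒ (Fin.all? (commonPointFreeClique? ∘ λ e → shiftClique e C₁)) refl

noncanonical-maximum-clique : ∀ {C} → 13 ≤ length C → CommonPointFreeClique C →
                              IsMaximumClique C × ¬ IsCanonical C
noncanonical-maximum-clique 13≤|C| (C-unique , C-meets , no-common-point) =
  ((C-unique , allPairs⇒pairwise intersect-sym C-meets) ,
   λ D D-clique → ≤-trans (clique-length≤13 D D-clique) 13≤|C|) ,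
  no-common-point ∘ canonical⇒commonPoint

corollary3p2 : (e : Fin 13) → IsMaximumClique (shiftClique e C₁) × ¬ IsCanonical (shiftClique e C₁)
corollary3p2 e = noncanonical-maximum-clique ℕ.≤-refl (C₁-translates-commonPointFree e)
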